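{- Let $q\geq 3$ be odd and let $\gamma$ be an integer with $\gamma\leq q$. A completely regular code in $H(3,q)$ with covering radius $1$, eigenvalue $\lambda_2(3,q)$ and parameter $\gamma$ exists if and only if $\gamma$ is a positive even integer.
   Context: Let $\mathcal{A}$ be a set of size $q$; $H(3,q)$ has vertex set $\mathcal{A}^3$, tuples adjacent iff they differ in exactly one position; $\lambda_2(3,q)=q-3$. A set $C$ of vertices is a completely regular code with covering radius $1$ if $C$ is a nonempty proper subset and there are integers $\beta,\gamma\geq1$ such that every vertex of $C$ has exactly $\beta$ neighbours outside $C$ and every vertex outside $C$ has exactly $\gamma$ neighbours in $C$; it has eigenvalue $\lambda_2(3,q)$ iff $\beta+\gamma=2q$ (so $\gamma\leq q$ is equivalent to $\gamma\leq\beta$). -}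

module Defs where

open import Data.Nat using (ℕ; zero; suc; _+_)
open import Data.Fin using (Fin)
open import Data.Fin.Properties using (_≟_)
open import Data.Bool using (Bool; true; false; if_then_else_)
open import Data.List using (List; allFin; cartesianProduct; map; length; filter)
open import Data.Product using (_×_; _,_; ∃)
open import Data.Integer as ℤ using (ℤ; +_; _-_)
open import Relation.Nullary using (¬_; does)
open import Relation.Nullary.Decidable using (⌊_⌋)
open import Relation.Binary.PropositionalEquality using (_≡_)

Vertex : ℕ → Set
Vertex q = Fin q × Fin q × Fin q

allVertices : (q : ℕ) → List (Vertex q)
allVertices q = cartesianProduct (allFin q) (cartesianProduct (allFin q) (allFin q))

diff : {q : ℕ} → Fin q → Fin q → ℕ
diff a b = if does (a ≟ b) then 0 else 1

dist : {q : ℕ} → Vertex q → Vertex q → ℕ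
dist (a₁ , a₂ , a₃) (b₁ , b₂ , b₃) = diff a₁ b₁ + diff a₂ b₂ + diff a₃ b₃

adjacent? : {q : ℕ} → Vertex q → Vertex q → Bool
adjacent? u v = ⌊ Data.Nat._≟_ (dist u v) 1 ⌋

Code : ℕ → Set
Code q = Vertex q → Bool

nbrsIn : {q : ℕ} → Code q → Vertex q → ℕ
nbrsIn {q} C v = length (filter (λ w → (adjacent? v w ∧ C w) Data.Bool.≟ true) (allVertices q))
  where open import Data.Bool using (_∧_)

nbrsOut : {q : ℕ} → Code q → Vertex q → ℕ
nbrsOut {q} C v = length (filter (λ w → (adjacent? v w ∧ not (C w)) Data.Bool.≟ true) (allVertices q))
  where open import Data.Bool using (_∧_; not)

-- C is a completely regular code with covering radius 1 in H(3,q),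
-- with parameters β (outer degree of codewords) and γ (number of
-- codeword neighbours of non-codewords).
record IsCRC1 (q : ℕ) (C : Code q) (β γ : ℤ) : Set where
  field
    nonempty   : ∃ λ v → C v ≡ true
    proper     : ∃ λ v → C v ≡ false
    β≥1        : + 1 ℤ.≤ β
    γ≥1        : + 1 ℤ.≤ γ
    inC        : ∀ v → C v ≡ true  → + nbrsOut C v ≡ β
    outC       : ∀ v → C v ≡ false → + nbrsIn C v ≡ γ

-- The (non-principal) eigenvalue of a completely regular code with
-- covering radius 1 and parameters β, γ in H(n,q): the second eigenvalue
-- n(q-1) - β - γ of its quotient matrix [[n(q-1)-β, β], [γ, n(q-1)-γ]].
eigenvalue : (n q : ℕ) (β γ : ℤ) → ℤ
eigenvalue n q β γ = + (n Data.Nat.* (q Data.Nat.∸ 1)) - β - γ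

λ₂ : ℕ → ℤ
λ₂ q = + q - + 3

-- Necessity is double counting: counting the edges between C and its complement
-- gives β |C| = γ (q³ - |C|), which together with β + γ = 2q becomes
-- 2 |C| = q² γ; as q is odd, γ is even.
-- For sufficiency write γ = 2k and take the cyclic band
-- S x y = [(x + y) mod q < k], a 0/1 matrix all of whose rows and columns contain
-- k ones, and the code C = {(x , y , z) | S x y}. A vertex (a , b , c) outside C
-- has k neighbours in C on each of the lines through it in the first two
-- directions and none on the third, since membership ignores z; so γ = 2k, and
-- likewise β = 2 (q - k).
module Submission where

open import Defs
open import Algebra.Properties.CommutativeSemigroup using (x∙yz≈z∙yx)
open import Data.Bool as Bool using (Bool; true; false; not; _∧_)
open import Data.Bool.Properties using (not-injective)
open import Data.Fin using (Fin; zero; suc; toℕ; fromℕ; fromℕ<; inject₁)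
open import Data.Fin.Properties using (_≟_; toℕ<n; toℕ-inject₁; toℕ-fromℕ; toℕ-fromℕ<)
open import Data.Integer as ℤ using (ℤ; +_; +≤+; +<+)
open import Data.Integer.Divisibility as ℤD using ()
open import Data.Integer.Properties using (pos-*; +-injective; i≡j⇒i-j≡0; i-j≡0⇒i≡j)
open import Data.Integer.Tactic.RingSolver using (solve-∀)
open import Data.List
  using (List; []; _∷_; _++_; map; length; filter; tabulate; cartesianProduct; allFin)
open import Data.List.Properties using (map-++; map-∘)
open import Data.Nat as ℕ
  using (ℕ; zero; suc; _+_; _*_; _∸_; _⊓_; _≤_; _<_; _≥_; _<ᵇ_; NonZero; ≢-nonZero; z≤n; s≤s)
open import Data.Nat.DivMod using (_%_; %-congˡ; [m+n]%n≡m%n; m<n⇒m%n≡m)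
open import Data.Nat.Divisibility using (_∣_; divides; _∣0)
open import Data.Nat.ListAction using () renaming (sum to listSum)
open import Data.Nat.ListAction.Properties using () renaming (sum-++ to listSum-++)
open import Data.Nat.Primality using (euclidsLemma; prime[2])
open import Data.Nat.Properties
  using ( +-*-semiring; *-commutativeSemigroup; +-assoc; +-comm; +-suc; +-identityʳ
        ; +-cancelˡ-≡; *-comm; *-assoc; *-identityʳ; *-distribˡ-+; *-distribʳ-+
        ; *-cancelˡ-≡; *-cancelˡ-<; m+n∸m≡n; m∸n+n≡m; m≥n⇒m⊓n≡n; m≤m+n; m<m+n
        ; m<n⇒0<n∸m; ≤-trans; <-≤-trans; <⇒≤ )
open import Data.Nat.Tactic.RingSolver as ℕ-Solver using ()
open import Algebra.Properties.Semiring.Sum +-*-semiring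
  using ( sum-syntax; sum-cong-≗; ∑-distrib-+; ∑-comm; *-distribˡ-sum
        ; sum-init-last; sum-replicate-zero )
open import Data.Product using (_×_; _,_; ∃₂)
open import Data.Sum using ([_,_]′)
open import Function using (_∘_; id; _⇔_; mk⇔; Equivalence)
open import Relation.Nullary using (¬_; does; yes; no)
open import Relation.Nullary.Decidable using (⌊_⌋)
open import Relation.Nullary.Negation using (contradiction; contradiction₂)
open import Relation.Binary.PropositionalEquality using (_≡_; refl; sym; trans; cong; cong₂)
open Relation.Binary.PropositionalEquality.≡-Reasoning

𝟙 : Bool → ℕ
𝟙 true  = 1
𝟙 false = 0

𝟙-∧ : ∀ a b → 𝟙 (a ∧ b) ≡ 𝟙 a * 𝟙 b
𝟙-∧ true  b = sym (+-identityʳ (𝟙 b))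
𝟙-∧ false b = refl

𝟙+𝟙-not : ∀ b → 𝟙 b + 𝟙 (not b) ≡ 1
𝟙+𝟙-not true  = refl
𝟙+𝟙-not false = refl

𝟙*-cong : ∀ b {m n} → (b ≡ true → m ≡ n) → 𝟙 b * m ≡ 𝟙 b * n
𝟙*-cong true  m≡n = cong (_+ 0) (m≡n refl)
𝟙*-cong false _   = refl

δ : ∀ {n} → Fin n → Fin n → ℕ
δ a x = 𝟙 (does (a ≟ x))

∑-const : ∀ n c → ∑[ i < n ] c ≡ n * c
∑-const zero    c = refl
∑-const (suc n) c = cong (_+_ c) (∑-const n c)

∑-𝟙+∑-𝟙-not : ∀ {n} (f : Fin n → Bool) → ∑[ i < n ] 𝟙 (f i) + ∑[ i < n ] 𝟙 (not (f i)) ≡ n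
∑-𝟙+∑-𝟙-not {n} f = begin
  ∑[ i < n ] 𝟙 (f i) + ∑[ i < n ] 𝟙 (not (f i)) ≡⟨ ∑-distrib-+ (𝟙 ∘ f) (𝟙 ∘ not ∘ f) ⟨
  ∑[ i < n ] (𝟙 (f i) + 𝟙 (not (f i)))          ≡⟨ sum-cong-≗ (𝟙+𝟙-not ∘ f) ⟩
  ∑[ i < n ] 1                                  ≡⟨ ∑-const n 1 ⟩
  n * 1                                         ≡⟨ *-identityʳ n ⟩
  n                                             ∎

∑-𝟙-not : ∀ {n} (f : Fin n → Bool) → ∑[ i < n ] 𝟙 (not (f i)) ≡ n ∸ ∑[ i < n ] 𝟙 (f i)
∑-𝟙-not {n} f = begin
  ∑¬f            ≡⟨ m+n∸m≡n ∑f ∑¬f ⟨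
  ∑f + ∑¬f ∸ ∑f  ≡⟨ cong (_∸ ∑f) (∑-𝟙+∑-𝟙-not f) ⟩
  n ∸ ∑f         ∎
  where
  ∑f ∑¬f : ℕ
  ∑f  = ∑[ i < n ] 𝟙 (f i)
  ∑¬f = ∑[ i < n ] 𝟙 (not (f i))

∑-δ : ∀ {n} (b : Fin n) (f : Fin n → ℕ) → ∑[ y < n ] (δ b y * f y) ≡ f b
∑-δ {suc n} zero    f =
  trans (cong₂ _+_ (+-identityʳ (f zero)) (sum-replicate-zero n)) (+-identityʳ (f zero))
∑-δ {suc n} (suc b) f = ∑-δ b (f ∘ suc)

∑-δ-* : ∀ {n} k (c : Fin n) (f : Fin n → ℕ) → ∑[ z < n ] ((k * δ c z) * f z) ≡ k * f c
∑-δ-* {n} k c f = begin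
  ∑[ z < n ] ((k * δ c z) * f z) ≡⟨ sum-cong-≗ (λ z → *-assoc k (δ c z) (f z)) ⟩
  ∑[ z < n ] (k * (δ c z * f z)) ≡⟨ *-distribˡ-sum k (λ z → δ c z * f z) ⟨
  k * ∑[ z < n ] (δ c z * f z)   ≡⟨ cong (_*_ k) (∑-δ c f) ⟩
  k * f c                        ∎

∑-<ᵇ : ∀ n k → ∑[ x < n ] 𝟙 (toℕ x <ᵇ k) ≡ n ⊓ k
∑-<ᵇ zero    k       = refl
∑-<ᵇ (suc n) zero    = sum-replicate-zero n
∑-<ᵇ (suc n) (suc k) = cong suc (∑-<ᵇ n k)

∑-rotate : ∀ {n} (Q : ℕ → ℕ) → Q n ≡ Q 0 → ∑[ x < n ] Q (suc (toℕ x)) ≡ ∑[ x < n ] Q (toℕ x)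
∑-rotate {n} Q Qn≡Q0 = +-cancelˡ-≡ (Q 0) _ _ (begin
  Q 0 + ∑[ x < n ] Q (suc (toℕ x))
    ≡⟨ sum-init-last (Q ∘ toℕ) ⟩
  ∑[ x < n ] Q (toℕ (inject₁ x)) + Q (toℕ (fromℕ n))
    ≡⟨ cong₂ _+_ (sum-cong-≗ {n} (cong Q ∘ toℕ-inject₁)) (cong Q (toℕ-fromℕ n)) ⟩
  ∑[ x < n ] Q (toℕ x) + Q n
    ≡⟨ cong (_+_ _) Qn≡Q0 ⟩
  ∑[ x < n ] Q (toℕ x) + Q 0
    ≡⟨ +-comm _ (Q 0) ⟩
  Q 0 + ∑[ x < n ] Q (toℕ x) ∎)

∑-shift : ∀ {n} (P : ℕ → ℕ) → (∀ m → P (n + m) ≡ P m) →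
          ∀ t → ∑[ x < n ] P (toℕ x + t) ≡ ∑[ x < n ] P (toℕ x)
∑-shift {n} P periodic zero    = sum-cong-≗ {n} (λ x → cong P (+-identityʳ (toℕ x)))
∑-shift {n} P periodic (suc t) = begin
  ∑[ x < n ] P (toℕ x + suc t)   ≡⟨ sum-cong-≗ {n} (λ x → cong P (+-suc (toℕ x) t)) ⟩
  ∑[ x < n ] P (suc (toℕ x) + t) ≡⟨ ∑-rotate {n} (λ m → P (m + t)) (periodic t) ⟩
  ∑[ x < n ] P (toℕ x + t)       ≡⟨ ∑-shift P periodic t ⟩
  ∑[ x < n ] P (toℕ x)           ∎

∑-mod-<ᵇ : ∀ {q} .{{_ : NonZero q}} {k} → k ≤ q →
           ∀ t → ∑[ x < q ] 𝟙 ((toℕ x + t) % q <ᵇ k) ≡ k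
∑-mod-<ᵇ {q} {k} k≤q t = begin
  ∑[ x < q ] 𝟙 ((toℕ x + t) % q <ᵇ k) ≡⟨ ∑-shift {q} P periodic t ⟩
  ∑[ x < q ] 𝟙 (toℕ x % q <ᵇ k)       ≡⟨ sum-cong-≗ {q} (cong below-k ∘ m<n⇒m%n≡m ∘ toℕ<n) ⟩
  ∑[ x < q ] 𝟙 (toℕ x <ᵇ k)           ≡⟨ ∑-<ᵇ q k ⟩
  q ⊓ k                                ≡⟨ m≥n⇒m⊓n≡n k≤q ⟩
  k                                    ∎
  where
  below-k P : ℕ → ℕ
  below-k m = 𝟙 (m <ᵇ k)
  P m = below-k (m % q)

  periodic : ∀ m → P (q + m) ≡ P m
  periodic m = cong below-k (trans (%-congˡ (+-comm q m)) ([m+n]%n≡m%n m q))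

<ᵇ-irrefl : ∀ n → (n <ᵇ n) ≡ false
<ᵇ-irrefl zero    = refl
<ᵇ-irrefl (suc n) = <ᵇ-irrefl n

Regular : ∀ {q} → ℕ → (Fin q → Fin q → Bool) → Set
Regular {q} k S = (∀ a → ∑[ y < q ] 𝟙 (S a y) ≡ k) × (∀ b → ∑[ x < q ] 𝟙 (S x b) ≡ k)

Regular-not : ∀ {q k S} → Regular {q} k S → Regular (q ∸ k) (λ x y → not (S x y))
Regular-not {q} {k} {S} (rows , cols) =
  (λ a → trans (∑-𝟙-not (S a)) (cong (q ∸_) (rows a))) ,
  (λ b → trans (∑-𝟙-not (λ x → S x b)) (cong (q ∸_) (cols b)))

cyclicBand : ∀ q .{{_ : NonZero q}} → ℕ → Fin q → Fin q → Bool
cyclicBand q k x y = (toℕ x + toℕ y) % q <ᵇ k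

cyclicBand-regular : ∀ {q} .{{_ : NonZero q}} {k} → k ≤ q → Regular k (cyclicBand q k)
cyclicBand-regular {q} {k} k≤q =
  (λ a → trans (sum-cong-≗ {q} (λ y → cong (λ m → 𝟙 (m % q <ᵇ k)) (+-comm (toℕ a) (toℕ y))))
               (∑-mod-<ᵇ k≤q (toℕ a))) ,
  (λ b → ∑-mod-<ᵇ k≤q (toℕ b))

∑V : ∀ {q} → (Vertex q → ℕ) → ℕ
∑V {q} f = ∑[ x < q ] ∑[ y < q ] ∑[ z < q ] f (x , y , z)

∑V-cong : ∀ {q} {f g : Vertex q → ℕ} → (∀ v → f v ≡ g v) → ∑V f ≡ ∑V g
∑V-cong {q} f≗g =
  sum-cong-≗ {q} λ x → sum-cong-≗ {q} λ y → sum-cong-≗ {q} λ z → f≗g (x , y , z)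

∑V-distrib-+ : ∀ {q} (f g : Vertex q → ℕ) → ∑V (λ v → f v + g v) ≡ ∑V f + ∑V g
∑V-distrib-+ {q} f g =
  trans (sum-cong-≗ {q} λ x →
           trans (sum-cong-≗ {q} λ y → ∑-distrib-+ (λ z → f (x , y , z)) (λ z → g (x , y , z)))
                 (∑-distrib-+ (λ y → ∑[ z < q ] f (x , y , z)) (λ y → ∑[ z < q ] g (x , y , z))))
        (∑-distrib-+ (λ x → ∑[ y < q ] ∑[ z < q ] f (x , y , z))
                     (λ x → ∑[ y < q ] ∑[ z < q ] g (x , y , z)))

*-distribˡ-∑V : ∀ {q} k (f : Vertex q → ℕ) → k * ∑V f ≡ ∑V (λ v → k * f v)
*-distribˡ-∑V {q} k f =
  trans (*-distribˡ-sum k (λ x → ∑[ y < q ] ∑[ z < q ] f (x , y , z)))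
        (sum-cong-≗ {q} λ x →
           trans (*-distribˡ-sum k (λ y → ∑[ z < q ] f (x , y , z)))
                 (sum-cong-≗ {q} λ y → *-distribˡ-sum k (λ z → f (x , y , z))))

∑-∑V-comm : ∀ {m q} (F : Fin m → Vertex q → ℕ) →
            ∑[ i < m ] ∑V (F i) ≡ ∑V (λ v → ∑[ i < m ] F i v)
∑-∑V-comm {m} {q} F =
  trans (∑-comm (λ i x → ∑[ y < q ] ∑[ z < q ] F i (x , y , z)))
        (sum-cong-≗ {q} λ x →
           trans (∑-comm (λ i y → ∑[ z < q ] F i (x , y , z)))
                 (sum-cong-≗ {q} λ y → ∑-comm (λ i z → F i (x , y , z))))

∑V-comm : ∀ {q} (F : Vertex q → Vertex q → ℕ) →
          ∑V (λ v → ∑V (F v)) ≡ ∑V (λ w → ∑V (λ v → F v w))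
∑V-comm {q} F =
  trans (sum-cong-≗ {q} λ x →
           trans (sum-cong-≗ {q} λ y → ∑-∑V-comm (λ z → F (x , y , z)))
                 (∑-∑V-comm (λ y w → ∑[ z < q ] F (x , y , z) w)))
        (∑-∑V-comm (λ x w → ∑[ y < q ] ∑[ z < q ] F (x , y , z) w))

∑V-1 : ∀ q → ∑V {q} (λ _ → 1) ≡ q * (q * q)
∑V-1 q = begin
  ∑V {q} (λ _ → 1)
    ≡⟨ sum-cong-≗ {q} (λ _ → trans (sum-cong-≗ {q} λ _ → ∑-const q 1) (∑-const q (q * 1))) ⟩
  ∑[ x < q ] (q * (q * 1))  ≡⟨ ∑-const q _ ⟩
  q * (q * (q * 1))         ≡⟨ cong (λ m → q * (q * m)) (*-identityʳ q) ⟩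
  q * (q * q)               ∎

∑V-𝟙+∑V-𝟙-not : ∀ {q} (C : Code q) → ∑V (λ v → 𝟙 (C v)) + ∑V (λ v → 𝟙 (not (C v))) ≡ q * (q * q)
∑V-𝟙+∑V-𝟙-not {q} C =
  trans (sym (∑V-distrib-+ (𝟙 ∘ C) (𝟙 ∘ not ∘ C))) (trans (∑V-cong (𝟙+𝟙-not ∘ C)) (∑V-1 q))

∑V-𝟙*-const : ∀ {q} (b : Vertex q → Bool) (m : Vertex q → ℕ) k → (∀ v → b v ≡ true → m v ≡ k) →
              ∑V (λ v → 𝟙 (b v) * m v) ≡ k * ∑V (λ v → 𝟙 (b v))
∑V-𝟙*-const b m k m≡k =
  trans (∑V-cong (λ v → trans (𝟙*-cong (b v) (m≡k v)) (*-comm (𝟙 (b v)) k)))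
        (sym (*-distribˡ-∑V k (λ v → 𝟙 (b v))))

∑V-symmetric : ∀ {q} (A : Vertex q → Vertex q → ℕ) → (∀ v w → A v w ≡ A w v) →
               (f g : Vertex q → ℕ) →
               ∑V (λ v → f v * ∑V (λ w → A v w * g w)) ≡ ∑V (λ w → g w * ∑V (λ v → A w v * f v))
∑V-symmetric A A-sym f g = begin
  ∑V (λ v → f v * ∑V (λ w → A v w * g w))
    ≡⟨ ∑V-cong (λ v → *-distribˡ-∑V (f v) (λ w → A v w * g w)) ⟩
  ∑V (λ v → ∑V (λ w → f v * (A v w * g w)))
    ≡⟨ ∑V-comm (λ v w → f v * (A v w * g w)) ⟩
  ∑V (λ w → ∑V (λ v → f v * (A v w * g w)))
    ≡⟨ ∑V-cong (λ w → ∑V-cong (λ v → swap v w)) ⟩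
  ∑V (λ w → ∑V (λ v → g w * (A w v * f v)))
    ≡⟨ ∑V-cong (λ w → *-distribˡ-∑V (g w) (λ v → A w v * f v)) ⟨
  ∑V (λ w → g w * ∑V (λ v → A w v * f v)) ∎
  where
  swap : ∀ v w → f v * (A v w * g w) ≡ g w * (A w v * f v)
  swap v w = trans (cong (λ a → f v * (a * g w)) (A-sym v w))
                   (x∙yz≈z∙yx *-commutativeSemigroup (f v) (A w v) (g w))

length-filter-≟true : ∀ {A : Set} (f : A → Bool) (xs : List A) →
                      length (filter (λ x → f x Bool.≟ true) xs) ≡ listSum (map (𝟙 ∘ f) xs)
length-filter-≟true f []       = refl
length-filter-≟true f (x ∷ xs) with f x
... | true  = cong suc (length-filter-≟true f xs)
... | false = length-filter-≟true f xs

listSum-map-cartesianProduct : ∀ {A B : Set} (g : A × B → ℕ) (xs : List A) (ys : List B) →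
  listSum (map g (cartesianProduct xs ys))
    ≡ listSum (map (λ x → listSum (map (λ y → g (x , y)) ys)) xs)
listSum-map-cartesianProduct g []       ys = refl
listSum-map-cartesianProduct g (x ∷ xs) ys = begin
  listSum (map g (map (x ,_) ys ++ cartesianProduct xs ys))
    ≡⟨ cong listSum (map-++ g (map (x ,_) ys) (cartesianProduct xs ys)) ⟩
  listSum (map g (map (x ,_) ys) ++ map g (cartesianProduct xs ys))
    ≡⟨ listSum-++ (map g (map (x ,_) ys)) (map g (cartesianProduct xs ys)) ⟩
  listSum (map g (map (x ,_) ys)) + listSum (map g (cartesianProduct xs ys))
    ≡⟨ cong₂ _+_ (cong listSum (sym (map-∘ ys))) (listSum-map-cartesianProduct g xs ys) ⟩
  listSum (map (λ y → g (x , y)) ys) + listSum (map (λ x → listSum (map (λ y → g (x , y)) ys)) xs) ∎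

listSum-map-tabulate : ∀ {A : Set} {n} (g : A → ℕ) (h : Fin n → A) →
                       listSum (map g (tabulate h)) ≡ ∑[ i < n ] g (h i)
listSum-map-tabulate {n = zero}  g h = refl
listSum-map-tabulate {n = suc n} g h = cong (_+_ (g (h zero))) (listSum-map-tabulate g (h ∘ suc))

listSum-map-allVertices : ∀ q (g : Vertex q → ℕ) → listSum (map g (allVertices q)) ≡ ∑V g
listSum-map-allVertices q g =
  trans (listSum-map-cartesianProduct g (allFin q) _)
  (trans (listSum-map-tabulate {n = q} _ id)
         (sum-cong-≗ {q} λ x →
            trans (listSum-map-cartesianProduct (λ yz → g (x , yz)) (allFin q) (allFin q))
            (trans (listSum-map-tabulate {n = q} _ id)
                   (sum-cong-≗ {q} λ y → listSum-map-tabulate (λ z → g (x , y , z)) id))))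

nbrsIn-∑V : ∀ {q} (C : Code q) v → nbrsIn C v ≡ ∑V (λ w → 𝟙 (adjacent? v w) * 𝟙 (C w))
nbrsIn-∑V {q} C v = begin
  nbrsIn C v
    ≡⟨ length-filter-≟true (λ w → adjacent? v w ∧ C w) (allVertices q) ⟩
  listSum (map (λ w → 𝟙 (adjacent? v w ∧ C w)) (allVertices q))
    ≡⟨ listSum-map-allVertices q _ ⟩
  ∑V (λ w → 𝟙 (adjacent? v w ∧ C w))
    ≡⟨ ∑V-cong (λ w → 𝟙-∧ (adjacent? v w) (C w)) ⟩
  ∑V (λ w → 𝟙 (adjacent? v w) * 𝟙 (C w)) ∎

nbrsOut≡nbrsIn-not : ∀ {q} (C : Code q) v → nbrsOut C v ≡ nbrsIn (not ∘ C) v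
nbrsOut≡nbrsIn-not C v = refl

diff-sym : ∀ {q} (a b : Fin q) → diff a b ≡ diff b a
diff-sym a b with a ≟ b | b ≟ a
... | yes _   | yes _   = refl
... | no  _   | no  _   = refl
... | yes a≡b | no  b≢a = contradiction (sym a≡b) b≢a
... | no  a≢b | yes b≡a = contradiction (sym b≡a) a≢b

adjacent?-sym : ∀ {q} (v w : Vertex q) → adjacent? v w ≡ adjacent? w v
adjacent?-sym (a₁ , a₂ , a₃) (b₁ , b₂ , b₃) =
  cong (λ d → ⌊ d ℕ.≟ 1 ⌋)
       (cong₂ _+_ (cong₂ _+_ (diff-sym a₁ b₁) (diff-sym a₂ b₂)) (diff-sym a₃ b₃))

-- The three products select the lines through (a , b , c); they overcount only
-- at (a , b , c) itself, where h vanishes.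
𝟙-adjacent : ∀ {q} (h : Vertex q → ℕ) (a b c x y z : Fin q) → h (a , b , c) ≡ 0 →
  𝟙 (adjacent? (a , b , c) (x , y , z)) * h (x , y , z)
    ≡ (δ b y * δ c z + δ a x * δ c z + δ a x * δ b y) * h (x , y , z)
𝟙-adjacent h a b c x y z hv with a ≟ x | b ≟ y | c ≟ z
... | yes refl | yes refl | yes refl rewrite hv = refl
... | yes _    | yes _    | no _     = refl
... | yes _    | no _     | yes _    = refl
... | yes _    | no _     | no _     = refl
... | no _     | yes _    | yes _    = refl
... | no _     | yes _    | no _     = refl
... | no _     | no _     | yes _    = refl
... | no _     | no _     | no _     = refl

∑V-adjacent : ∀ {q} (h : Vertex q → ℕ) (a b c : Fin q) → h (a , b , c) ≡ 0 →
  ∑V (λ w → 𝟙 (adjacent? (a , b , c) w) * h w)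
    ≡ ∑[ x < q ] h (x , b , c) + ∑[ y < q ] h (a , y , c) + ∑[ z < q ] h (a , b , z)
∑V-adjacent {q} h a b c hv = begin
  ∑V (λ w → 𝟙 (adjacent? (a , b , c) w) * h w)
    ≡⟨ ∑V-cong split ⟩
  ∑V (λ w → line₁ w + line₂ w + line₃ w)
    ≡⟨ ∑V-distrib-+ (λ w → line₁ w + line₂ w) line₃ ⟩
  ∑V (λ w → line₁ w + line₂ w) + ∑V line₃
    ≡⟨ cong (_+ ∑V line₃) (∑V-distrib-+ line₁ line₂) ⟩
  ∑V line₁ + ∑V line₂ + ∑V line₃
    ≡⟨ cong₂ _+_ (cong₂ _+_ ∑line₁ ∑line₂) ∑line₃ ⟩
  ∑[ x < q ] h (x , b , c) + ∑[ y < q ] h (a , y , c) + ∑[ z < q ] h (a , b , z) ∎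
  where
  line₁ line₂ line₃ : Vertex q → ℕ
  line₁ (x , y , z) = (δ b y * δ c z) * h (x , y , z)
  line₂ (x , y , z) = (δ a x * δ c z) * h (x , y , z)
  line₃ (x , y , z) = (δ a x * δ b y) * h (x , y , z)

  split : ∀ w → 𝟙 (adjacent? (a , b , c) w) * h w ≡ line₁ w + line₂ w + line₃ w
  split (x , y , z) = begin
    𝟙 (adjacent? (a , b , c) (x , y , z)) * h (x , y , z)
      ≡⟨ 𝟙-adjacent h a b c x y z hv ⟩
    (δ b y * δ c z + δ a x * δ c z + δ a x * δ b y) * h (x , y , z)
      ≡⟨ *-distribʳ-+ (h (x , y , z)) (δ b y * δ c z + δ a x * δ c z) (δ a x * δ b y) ⟩
    (δ b y * δ c z + δ a x * δ c z) * h (x , y , z) + line₃ (x , y , z)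
      ≡⟨ cong (_+ line₃ (x , y , z)) (*-distribʳ-+ (h (x , y , z)) (δ b y * δ c z) (δ a x * δ c z)) ⟩
    line₁ (x , y , z) + line₂ (x , y , z) + line₃ (x , y , z) ∎

  ∑line₁ : ∑V line₁ ≡ ∑[ x < q ] h (x , b , c)
  ∑line₁ = sum-cong-≗ {q} λ x →
    trans (sum-cong-≗ {q} λ y → ∑-δ-* (δ b y) c (λ z → h (x , y , z)))
          (∑-δ b (λ y → h (x , y , c)))

  ∑line₂ : ∑V line₂ ≡ ∑[ y < q ] h (a , y , c)
  ∑line₂ =
    trans (sum-cong-≗ {q} λ x →
             trans (sum-cong-≗ {q} λ y → ∑-δ-* (δ a x) c (λ z → h (x , y , z)))
                   (sym (*-distribˡ-sum (δ a x) (λ y → h (x , y , c)))))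
          (∑-δ a (λ x → ∑[ y < q ] h (x , y , c)))

  ∑line₃ : ∑V line₃ ≡ ∑[ z < q ] h (a , b , z)
  ∑line₃ =
    trans (sum-cong-≗ {q} λ x →
             trans (sum-cong-≗ {q} λ y →
                      sym (*-distribˡ-sum (δ a x * δ b y) (λ z → h (x , y , z))))
                   (∑-δ-* (δ a x) b (λ y → ∑[ z < q ] h (x , y , z))))
          (∑-δ a (λ x → ∑[ z < q ] h (x , b , z)))

edges-across : ∀ {q} (C : Code q) →
               ∑V (λ v → 𝟙 (C v) * nbrsOut C v) ≡ ∑V (λ v → 𝟙 (not (C v)) * nbrsIn C v)
edges-across C = begin
  ∑V (λ v → 𝟙 (C v) * nbrsOut C v)
    ≡⟨ ∑V-cong (λ v → cong (_*_ (𝟙 (C v))) (nbrsIn-∑V (not ∘ C) v)) ⟩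
  ∑V (λ v → 𝟙 (C v) * ∑V (λ w → 𝟙 (adjacent? v w) * 𝟙 (not (C w))))
    ≡⟨ ∑V-symmetric (λ v w → 𝟙 (adjacent? v w)) (λ v w → cong 𝟙 (adjacent?-sym v w))
                    (𝟙 ∘ C) (𝟙 ∘ not ∘ C) ⟩
  ∑V (λ w → 𝟙 (not (C w)) * ∑V (λ v → 𝟙 (adjacent? w v) * 𝟙 (C v)))
    ≡⟨ ∑V-cong (λ w → cong (_*_ (𝟙 (not (C w)))) (nbrsIn-∑V C w)) ⟨
  ∑V (λ v → 𝟙 (not (C v)) * nbrsIn C v) ∎

double-count⇒2∣γ : ∀ {q c c̄ β γ} → ¬ 2 ∣ q →
                   c + c̄ ≡ q * (q * q) → β * c ≡ γ * c̄ → β + γ ≡ 2 * q → 2 ∣ γ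
double-count⇒2∣γ {q} {c} {c̄} {β} {γ} odd c+c̄≡q³ βc≡γc̄ β+γ≡2q =
  [ (λ 2∣q² → contradiction₂ (euclidsLemma q q prime[2] 2∣q²) odd odd) , id ]′
    (euclidsLemma (q * q) γ prime[2] (divides c q²γ≡c2))
  where
  q²γ≡c2 : q * q * γ ≡ c * 2
  q²γ≡c2 = *-cancelˡ-≡ _ _ q {{≢-nonZero λ { refl → odd (2 ∣0) }}} (begin
    q * (q * q * γ)   ≡⟨ ℕ-Solver.solve (q ∷ γ ∷ []) ⟩
    γ * (q * (q * q)) ≡⟨ cong (_*_ γ) c+c̄≡q³ ⟨
    γ * (c + c̄)       ≡⟨ *-distribˡ-+ γ c c̄ ⟩
    γ * c + γ * c̄     ≡⟨ cong (_+_ (γ * c)) βc≡γc̄ ⟨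
    γ * c + β * c     ≡⟨ *-distribʳ-+ c γ β ⟨
    (γ + β) * c       ≡⟨ cong (_* c) (trans (+-comm γ β) β+γ≡2q) ⟩
    2 * q * c         ≡⟨ ℕ-Solver.solve (q ∷ c ∷ []) ⟩
    q * (c * 2)       ∎)

IsCRC1⇒2∣γ : ∀ {q C B G} → ¬ 2 ∣ q → IsCRC1 q C (+ B) (+ G) → B + G ≡ 2 * q → 2 ∣ G
IsCRC1⇒2∣γ {q} {C} {B} {G} odd crc =
  double-count⇒2∣γ odd (∑V-𝟙+∑V-𝟙-not C) edges
  where
  open IsCRC1 crc
  edges : B * ∑V (λ v → 𝟙 (C v)) ≡ G * ∑V (λ v → 𝟙 (not (C v)))
  edges = begin
    B * ∑V (λ v → 𝟙 (C v))
      ≡⟨ ∑V-𝟙*-const C (nbrsOut C) B (λ v → +-injective ∘ inC v) ⟨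
    ∑V (λ v → 𝟙 (C v) * nbrsOut C v)
      ≡⟨ edges-across C ⟩
    ∑V (λ v → 𝟙 (not (C v)) * nbrsIn C v)
      ≡⟨ ∑V-𝟙*-const (not ∘ C) (nbrsIn C) G (λ v → +-injective ∘ outC v ∘ not-injective) ⟩
    G * ∑V (λ v → 𝟙 (not (C v))) ∎

eigenvalue-λ₂-gap : ∀ n B G →
  eigenvalue 3 (suc n) (+ B) (+ G) ℤ.- λ₂ (suc n) ≡ + (2 * suc n) ℤ.- + (B + G)
eigenvalue-λ₂-gap n B G = begin
  + (3 * n) ℤ.- + B ℤ.- + G ℤ.- (+ suc n ℤ.- + 3)
    ≡⟨ cong (λ t → t ℤ.- + B ℤ.- + G ℤ.- (+ suc n ℤ.- + 3)) (pos-* 3 n) ⟩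
  + 3 ℤ.* + n ℤ.- + B ℤ.- + G ℤ.- (+ 1 ℤ.+ + n ℤ.- + 3)
    ≡⟨ gap (+ n) (+ B) (+ G) ⟩
  + 2 ℤ.* (+ 1 ℤ.+ + n) ℤ.- (+ B ℤ.+ + G)
    ≡⟨ cong (ℤ._- + (B + G)) (pos-* 2 (suc n)) ⟨
  + (2 * suc n) ℤ.- + (B + G) ∎
  where
  gap : ∀ x b g →
        + 3 ℤ.* x ℤ.- b ℤ.- g ℤ.- (+ 1 ℤ.+ x ℤ.- + 3) ≡ + 2 ℤ.* (+ 1 ℤ.+ x) ℤ.- (b ℤ.+ g)
  gap = solve-∀

eigenvalue≡λ₂⇔ : ∀ n B G → eigenvalue 3 (suc n) (+ B) (+ G) ≡ λ₂ (suc n) ⇔ B + G ≡ 2 * suc n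
eigenvalue≡λ₂⇔ n B G = mk⇔
  (λ eig → sym (+-injective (i-j≡0⇒i≡j _ _
     (trans (sym (eigenvalue-λ₂-gap n B G)) (i≡j⇒i-j≡0 eig)))))
  (λ B+G≡2q → i-j≡0⇒i≡j _ _
     (trans (eigenvalue-λ₂-gap n B G) (i≡j⇒i-j≡0 (cong +_ (sym B+G≡2q)))))

cylinder : ∀ {q} → (Fin q → Fin q → Bool) → Code q
cylinder S (x , y , _) = S x y

nbrsIn-cylinder : ∀ {q k} {S : Fin q → Fin q → Bool} → Regular k S →
                  ∀ a b c → S a b ≡ false → nbrsIn (cylinder S) (a , b , c) ≡ 2 * k
nbrsIn-cylinder {q} {k} {S} (rows , cols) a b c Sab≡false = begin
  nbrsIn (cylinder S) (a , b , c)
    ≡⟨ nbrsIn-∑V (cylinder S) (a , b , c) ⟩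
  ∑V (λ w → 𝟙 (adjacent? (a , b , c) w) * 𝟙 (cylinder S w))
    ≡⟨ ∑V-adjacent (𝟙 ∘ cylinder S) a b c (cong 𝟙 Sab≡false) ⟩
  ∑[ x < q ] 𝟙 (S x b) + ∑[ y < q ] 𝟙 (S a y) + ∑[ z < q ] 𝟙 (S a b)
    ≡⟨ cong₂ _+_ (cong₂ _+_ (cols b) (rows a))
                 (trans (sum-cong-≗ {q} (λ _ → cong 𝟙 Sab≡false)) (sum-replicate-zero q)) ⟩
  k + k + 0
    ≡⟨ +-assoc k k 0 ⟩
  2 * k ∎

nbrsOut-cylinder : ∀ {q k} {S : Fin q → Fin q → Bool} → Regular k S →
                   ∀ a b c → S a b ≡ true → nbrsOut (cylinder S) (a , b , c) ≡ 2 * (q ∸ k)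
nbrsOut-cylinder {S = S} regular a b c Sab≡true =
  trans (nbrsOut≡nbrsIn-not (cylinder S) (a , b , c))
        (nbrsIn-cylinder (Regular-not regular) a b c (cong not Sab≡true))

cyclicCode-IsCRC1 : ∀ n k → 0 < k → k < suc n →
  IsCRC1 (suc n) (cylinder (cyclicBand (suc n) k)) (+ (2 * (suc n ∸ k))) (+ (2 * k))
cyclicCode-IsCRC1 n k@(suc _) (s≤s z≤n) k<q = record
  { nonempty = (zero , zero , zero) , refl
  ; proper   = (fromℕ< k<q , zero , zero) , k∉band
  ; β≥1      = +≤+ (≤-trans (m<n⇒0<n∸m k<q) (m≤m+n _ _))
  ; γ≥1      = +≤+ (s≤s z≤n)
  ; inC      = λ { (a , b , c) → cong +_ ∘ nbrsOut-cylinder regular a b c }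
  ; outC     = λ { (a , b , c) → cong +_ ∘ nbrsIn-cylinder regular a b c }
  }
  where
  regular : Regular k (cyclicBand (suc n) k)
  regular = cyclicBand-regular (<⇒≤ k<q)

  k∉band : cyclicBand (suc n) k (fromℕ< k<q) zero ≡ false
  k∉band = begin
    (toℕ (fromℕ< k<q) + 0) % suc n <ᵇ k
      ≡⟨ cong (λ m → m % suc n <ᵇ k) (trans (+-identityʳ _) (toℕ-fromℕ< k<q)) ⟩
    k % suc n <ᵇ k
      ≡⟨ cong (_<ᵇ k) (m<n⇒m%n≡m k<q) ⟩
    k <ᵇ k
      ≡⟨ <ᵇ-irrefl k ⟩
    false ∎

cyclicCode-eigenvalue : ∀ n k → k ≤ suc n →
  eigenvalue 3 (suc n) (+ (2 * (suc n ∸ k))) (+ (2 * k)) ≡ λ₂ (suc n)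
cyclicCode-eigenvalue n k k≤q = Equivalence.from (eigenvalue≡λ₂⇔ n (2 * (suc n ∸ k)) (2 * k)) (begin
  2 * (suc n ∸ k) + 2 * k ≡⟨ *-distribˡ-+ 2 (suc n ∸ k) k ⟨
  2 * (suc n ∸ k + k)     ≡⟨ cong (_*_ 2) (m∸n+n≡m k≤q) ⟩
  2 * suc n               ∎)

IsCRC1⇒γ-even : ∀ {n C β γ} → ¬ 2 ∣ suc n →
                IsCRC1 (suc n) C β γ → eigenvalue 3 (suc n) β γ ≡ λ₂ (suc n) →
                + 0 ℤ.< γ × (+ 2) ℤD.∣ γ
IsCRC1⇒γ-even {n} odd crc eig with IsCRC1.β≥1 crc | IsCRC1.γ≥1 crc
... | +≤+ {n = B} _ | +≤+ {n = G} 1≤G =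
  +<+ 1≤G , IsCRC1⇒2∣γ odd crc (Equivalence.to (eigenvalue≡λ₂⇔ n B G) eig)

γ-even⇒IsCRC1 : ∀ n γ → γ ℤ.≤ + suc n → + 0 ℤ.< γ × (+ 2) ℤD.∣ γ →
  ∃₂ λ (C : Code (suc n)) (β : ℤ) → IsCRC1 (suc n) C β γ × eigenvalue 3 (suc n) β γ ≡ λ₂ (suc n)
γ-even⇒IsCRC1 n _ (+≤+ 2k≤q) (+<+ 0<2k , divides k refl) rewrite *-comm k 2 =
  cylinder (cyclicBand (suc n) k) , + (2 * (suc n ∸ k)) ,
  cyclicCode-IsCRC1 n k 0<k k<q , cyclicCode-eigenvalue n k (<⇒≤ k<q)
  where
  0<k : 0 < k
  0<k = *-cancelˡ-< 2 0 k 0<2k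

  k<q : k < suc n
  k<q = <-≤-trans (m<m+n k (<-≤-trans 0<k (m≤m+n k 0))) 2k≤q

proposition6 : (q : ℕ) → q ≥ 3 → ¬ (2 ∣ q) → (γ : ℤ) → γ ℤ.≤ + q →
    (∃₂ λ (C : Code q) (β : ℤ) → IsCRC1 q C β γ × eigenvalue 3 q β γ ≡ λ₂ q)
    ⇔ (+ 0 ℤ.< γ × (+ 2) ℤD.∣ γ)
proposition6 zero    ()
proposition6 (suc n) _  odd γ γ≤q =
  mk⇔ (λ (_ , _ , crc , eig) → IsCRC1⇒γ-even odd crc eig) (γ-even⇒IsCRC1 n γ γ≤q)
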